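{- Let $X$ be a set and let $(\mathcal{A}_i)_{i=0}^{t}$ be a layered sequence of pairwise disjoint saturated antichains in $\mathcal{P}(X)$. Then for every $0\le i\le t-1$, every $A\in\mathcal{A}_i$ is strictly contained in some $B\in\mathcal{A}_{i+1}$.
   Context: A collection $\mathcal{A}\subseteq\mathcal{P}(X)$ is an antichain if there are no $A,B\in\mathcal{A}$ with $A\subsetneq B$; it is saturated if moreover for every $S\in\mathcal{P}(X)\setminus\mathcal{A}$ there is $A\in\mathcal{A}$ with $A\subsetneq S$ or $S\subsetneq A$. A sequence $(\mathcal{D}_i)_{i=0}^{t}$ of subsets of $\mathcal{P}(X)$ is layered if for $1\le i\le t$, every $D\in\mathcal{D}_i$ strictly contains some $D'\in\mathcal{D}_{i-1}$. -}

module Defs where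

open import Level using (0ℓ)
open import Data.Nat using (ℕ; suc; _≤_; _<_)
open import Data.Product using (Σ; _×_)
open import Data.Sum using (_⊎_)
open import Relation.Nullary using (¬_)
open import Relation.Binary.PropositionalEquality using (_≢_)
open import Relation.Unary using (Pred; _⊆_; _∈_; _∉_)

Subset : Set → Set₁
Subset X = Pred X 0ℓ

Family : Set → Set₁
Family X = Subset X → Set

_⊊_ : {X : Set} → Subset X → Subset X → Set
A ⊊ B = (A ⊆ B) × ¬ (B ⊆ A)

IsAntichain : {X : Set} → Family X → Set₁
IsAntichain 𝒜 = ∀ A B → 𝒜 A → 𝒜 B → ¬ (A ⊊ B)

IsSaturatedAntichain : {X : Set} → Family X → Set₁
IsSaturatedAntichain 𝒜 =
  IsAntichain 𝒜 ×
  (∀ S → ¬ 𝒜 S → Σ _ λ A → 𝒜 A × ((A ⊊ S) ⊎ (S ⊊ A)))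

-- Layered sequence (𝒟_i)_{i=0}^{t}: for 1 ≤ i ≤ t every D ∈ 𝒟_i strictly
-- contains some D' ∈ 𝒟_{i-1}.  (Written with i+1 for 0 ≤ i < t.)
IsLayered : {X : Set} → ℕ → (ℕ → Family X) → Set₁
IsLayered t 𝒟 = ∀ i → i < t → ∀ D → 𝒟 (suc i) D → Σ _ λ D′ → 𝒟 i D′ × (D′ ⊊ D)

PairwiseDisjoint : {X : Set} → ℕ → (ℕ → Family X) → Set₁
PairwiseDisjoint t 𝒜 = ∀ i j → i ≤ t → j ≤ t → i ≢ j → ∀ S → 𝒜 i S → ¬ 𝒜 j S

-- A ∈ 𝒜ᵢ is not in 𝒜ᵢ₊₁, so by saturation it is strictly comparable with some
-- B ∈ 𝒜ᵢ₊₁. If B ⊊ A, layering gives D ∈ 𝒜ᵢ with D ⊊ B ⊊ A, contradicting that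
-- 𝒜ᵢ is an antichain; hence A ⊊ B.
module Submission where

open import Defs
open import Data.Nat using (ℕ; suc; _≤_; _<_)
open import Data.Nat.Properties using (<⇒≤; <⇒≢; n<1+n)
open import Data.Product using (Σ; _×_; _,_)
open import Data.Sum using (inj₁; inj₂)
open import Data.Empty using (⊥-elim)
open import Relation.Nullary using (¬_)

⊊-trans : {X : Set} {A B C : Subset X} → A ⊊ B → B ⊊ C → A ⊊ C
⊊-trans (A⊆B , _) (B⊆C , C⊈B) = (λ x → B⊆C (A⊆B x)) , λ C⊆A → C⊈B (λ x → A⊆B (C⊆A x))

saturated-above-antichain : {X : Set} {𝒜 𝒜′ : Family X}
  → IsAntichain 𝒜 → IsSaturatedAntichain 𝒜′
  → (∀ B → 𝒜′ B → Σ (Subset X) λ D → 𝒜 D × (D ⊊ B))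
  → ∀ A → 𝒜 A → ¬ 𝒜′ A → Σ (Subset X) λ B → 𝒜′ B × (A ⊊ B)
saturated-above-antichain anti (_ , saturated) below A A∈𝒜 A∉𝒜′
  with saturated A A∉𝒜′
... | B , B∈𝒜′ , inj₂ A⊊B = B , B∈𝒜′ , A⊊B
... | B , B∈𝒜′ , inj₁ B⊊A with below B B∈𝒜′
...   | D , D∈𝒜 , D⊊B = ⊥-elim (anti D A D∈𝒜 A∈𝒜 (⊊-trans D⊊B B⊊A))

lemma2p7 : (X : Set) (t : ℕ) (𝒜 : ℕ → Family X)
    → IsLayered t 𝒜
    → PairwiseDisjoint t 𝒜
    → (∀ i → i ≤ t → IsSaturatedAntichain (𝒜 i))
    → ∀ i → i < t → ∀ A → 𝒜 i A → Σ (Subset X) λ B → 𝒜 (suc i) B × (A ⊊ B)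
lemma2p7 X t 𝒜 layered disjoint saturated i i<t A A∈𝒜ᵢ =
  saturated-above-antichain antichainᵢ (saturated (suc i) i<t) (layered i i<t)
    A A∈𝒜ᵢ (disjoint i (suc i) (<⇒≤ i<t) i<t (<⇒≢ (n<1+n i)) A A∈𝒜ᵢ)
  where
  antichainᵢ : IsAntichain (𝒜 i)
  antichainᵢ with saturated i (<⇒≤ i<t)
  ... | antichain , _ = antichain
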